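{- Let $G$ be a finite group of order $n$ and let $m\ge 1$ be an integer. A $(G,m+1;1)$-difference matrix exists if and only if there exists a set $\{\theta_1=\mathrm{Id},\theta_2,\ldots,\theta_m\}\subseteq S_G$ such that $d(\mathcal{R}(G)\theta_{i'},\theta_i)=n-1$ for all $i,i'\in\{1,\ldots,m\}$ with $i\ne i'$.
   Context: Let $G=\{g_1=1_G,g_2,\ldots,g_n\}$. $S_G$ is the group of all bijections $G\to G$, acting on the right: the image of $g$ under $\sigma$ is written $g^\sigma$, and products are composed left to right, $g^{\sigma\tau}=(g^\sigma)^\tau$. For $j\in\{1,\ldots,n\}$ let $\gamma_j\in S_G$ be defined by $g^{\gamma_j}=gg_j$; the right regular representation is $\mathcal{R}(G)=\{\gamma_1,\ldots,\gamma_n\}\le S_G$. For $\sigma,\tau\in S_G$ the Hamming distance $d(\sigma,\tau)$ is $n$ minus the number of fixed points of $\sigma^{ -1}\tau$; for subsets $S,T\subseteq S_G$, $d(S,T)=\min\{d(\sigma,\tau):\sigma\in S,\tau\in T\}$, and for a single permutation $\tau$ one writes $d(S,\tau)=d(S,\{\tau\})$; $\mathcal{R}(G)\theta=\{\gamma\theta:\gamma\in\mathcal{R}(G)\}$. A $(G,k;1)$-difference matrix is a $k\times n$ matrix $D=(d_{ik})$ with entries in $G$ such that for any two distinct rows $i\ne j$, the elements $d_{ik}^{ -1}d_{jk}$, $k=1,\ldots,n$, are exactly the $n$ elements of $G$ (each occurring once). -}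

module Defs where

open import Data.Nat using (ℕ; suc; _∸_; _⊓_)
open import Data.Fin using (Fin; zero)
open import Data.Fin.Properties using (_≟_)
open import Data.List using (List; length; filter; map; foldr; allFin)
open import Data.Fin.Permutation using (Permutation′; permutation; _⟨$⟩ʳ_; _⟨$⟩ˡ_; _∘ₚ_; id)
open import Relation.Binary.PropositionalEquality using (_≡_; refl; sym; trans; cong)
open import Relation.Nullary using (¬_)
open import Algebra.Structures using (IsGroup)
open import Function.Definitions using (Bijective)

record FiniteGroup (n : ℕ) : Set where
  infixl 7 _∙_
  infix 8 _⁻¹
  field
    _∙_ : Fin n → Fin n → Fin n
    ε : Fin n
    _⁻¹ : Fin n → Fin n
    isGroup : IsGroup _≡_ _∙_ ε _⁻¹
  open IsGroup isGroup public
    using (assoc; identityˡ; identityʳ; inverseˡ; inverseʳ)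

module _ {n : ℕ} (G : FiniteGroup n) where
  open FiniteGroup G

  private
    rmul-inv : ∀ h x → (x ∙ h ⁻¹) ∙ h ≡ x
    rmul-inv h x = trans (assoc x (h ⁻¹) h)
                     (trans (cong (x ∙_) (inverseˡ h)) (identityʳ x))
    rmul-inv′ : ∀ h x → (x ∙ h) ∙ h ⁻¹ ≡ x
    rmul-inv′ h x = trans (assoc x h (h ⁻¹))
                     (trans (cong (x ∙_) (inverseʳ h)) (identityʳ x))

  -- γ_h : g ↦ g h   (element of the right regular representation R(G))
  γ : Fin n → Permutation′ n
  γ h = permutation (λ x → x ∙ h) (λ x → x ∙ h ⁻¹) (rmul-inv h) (rmul-inv′ h)

  IsDifferenceMatrix : (k : ℕ) → (Fin k → Fin n → Fin n) → Set
  IsDifferenceMatrix k D =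
    ∀ (i j : Fin k) → ¬ (i ≡ j) →
      Bijective _≡_ _≡_ (λ c → D i c ⁻¹ ∙ D j c)

  DifferenceMatrixExists : (k : ℕ) → Set
  DifferenceMatrixExists k =
    Data.Product.Σ (Fin k → Fin n → Fin n) (IsDifferenceMatrix k)
    where import Data.Product

fixCount : {n : ℕ} → (Fin n → Fin n) → ℕ
fixCount {n} f = length (filter (λ x → f x ≟ x) (allFin n))

-- Hamming distance d(σ,τ) = n − #fix(σ⁻¹τ), with right actions:
-- g^{σ⁻¹τ} = (g^{σ⁻¹})^τ
hamming : {n : ℕ} → Permutation′ n → Permutation′ n → ℕ
hamming {n} σ τ = n ∸ fixCount (λ g → τ ⟨$⟩ʳ (σ ⟨$⟩ˡ g))

-- d(R(G)θ, τ) = min over h ∈ G of d(γ_h θ, τ).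
-- (The fold starts at n, which is harmless since every distance is ≤ n
-- and the list is nonempty when n ≥ 1.)
distRθ : {n : ℕ} → FiniteGroup n → Permutation′ n → Permutation′ n → ℕ
distRθ {n} G θ τ = foldr _⊓_ n (map (λ h → hamming (γ G h ∘ₚ θ) τ) (allFin n))

-- Multiplying every column of a difference matrix on the left by the inverse of its first
-- entry, and then permuting the columns, makes row 0 constantly ε and row 1 the identity;
-- every other row then differs bijectively from row 0, so it is a bijection G → G, and
-- row i + 1 read as θᵢ⁻¹ gives the permutations. Conversely, for permutations θ, θ′ the
-- point g is fixed by (γ_h θ′)⁻¹ θ exactly when θ⁻¹(g)⁻¹ θ′⁻¹(g) = h, so the fixed-point
-- counts are the fibre sizes of c ↦ θ⁻¹(c)⁻¹ θ′⁻¹(c) and d(R(G)θ′, θ) = n − (largest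
-- fibre). This is n − 1 exactly when that map is injective, i.e. when the rows θ⁻¹, θ′⁻¹
-- form a difference pair.
module Submission where

open import Defs
open import Algebra.Bundles using (Group)
import Algebra.Properties.Group as GroupProperties
open import Data.Empty using (⊥-elim)
open import Data.Fin using (Fin; zero; suc; punchOut)
open import Data.Fin.Permutation
  using (Permutation′; _⟨$⟩ʳ_; _⟨$⟩ˡ_; _∘ₚ_; flip; inverseˡ; inverseʳ)
open import Data.Fin.Properties using (_≟_; any?; punchOut-injective; injective⇒≤; suc-injective)
open import Data.List using (List; []; _∷_; length; filter; map; foldr; allFin)
open import Data.List.Membership.Propositional using (_∈_)
open import Data.List.Membership.Propositional.Properties
  using (∈-allFin; ∈-filter⁺; ∈-filter⁻; ∈-length)
open import Data.List.Properties using (length-filter; length-tabulate)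
open import Data.List.Relation.Unary.All using (_∷_)
open import Data.List.Relation.Unary.AllPairs using (_∷_)
open import Data.List.Relation.Unary.Any using (here; there)
open import Data.List.Relation.Unary.Unique.Propositional using (Unique)
open import Data.List.Relation.Unary.Unique.Propositional.Properties using (allFin⁺; filter⁺)
open import Data.Nat using (ℕ; suc; _∸_; _⊓_; _≤_; z≤n; s≤s)
open import Data.Nat.Properties
  using (≤-trans; ≤-reflexive; ≤-antisym; <-irrefl; m≤n⇒m≤1+n; 1+n≰n;
         ⊓-glb; m⊓n≤m; m⊓n≤n; m∸n≤m; ∸-monoʳ-≤; ∸-monoʳ-<; module ≤-Reasoning)
open import Data.Product using (Σ; _×_; _,_; proj₁; proj₂)
open import Function.Base using (_∘_; id; const)
open import Function.Bundles using (_⇔_; mk⇔; mk⤖; Bijection; Equivalence)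
open import Function.Consequences.Propositional using (strictlySurjective⇒surjective)
import Function.Construct.Composition as Composition
open import Function.Definitions using (Injective; StrictlySurjective; Bijective)
open import Function.Properties.Bijection using (⤖⇒↔)
open import Function.Properties.Inverse using (↔⇒⤖)
open import Level using (0ℓ)
open import Relation.Binary.PropositionalEquality
  using (_≡_; _≢_; refl; sym; trans; cong; _≗_; module ≡-Reasoning)
open import Relation.Nullary using (¬_; yes; no; contradiction)
open import Relation.Unary using (Pred; Decidable)

≗-injective : ∀ {A B : Set} {f g : A → B} → f ≗ g → Injective _≡_ _≡_ f → Injective _≡_ _≡_ g
≗-injective f≗g f-inj {x} {y} gx≡gy = f-inj (trans (f≗g x) (trans gx≡gy (sym (f≗g y))))

module _ {A : Set} where

  ∈-≢⇒2≤length : ∀ {x y : A} {xs} → x ∈ xs → y ∈ xs → x ≢ y → 2 ≤ length xs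
  ∈-≢⇒2≤length (here refl) (here refl) x≢y = ⊥-elim (x≢y refl)
  ∈-≢⇒2≤length (here _)    (there y∈)  _   = s≤s (∈-length y∈)
  ∈-≢⇒2≤length (there x∈)  (here _)    _   = s≤s (∈-length x∈)
  ∈-≢⇒2≤length (there x∈)  (there y∈)  x≢y = m≤n⇒m≤1+n (∈-≢⇒2≤length x∈ y∈ x≢y)

  unique-constant⇒length≤1 : ∀ {xs : List A} → Unique xs →
                             (∀ {x y} → x ∈ xs → y ∈ xs → x ≡ y) → length xs ≤ 1
  unique-constant⇒length≤1 {[]}          _                 _     = z≤n
  unique-constant⇒length≤1 {_ ∷ []}      _                 _     = s≤s z≤n
  unique-constant⇒length≤1 {_ ∷ _ ∷ _} ((x≢y ∷ _) ∷ _) const =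
    ⊥-elim (x≢y (const (here refl) (there (here refl))))

  module _ {P : Pred A 0ℓ} (P? : Decidable P) where

    1≤length-filter : ∀ {x xs} → x ∈ xs → P x → 1 ≤ length (filter P? xs)
    1≤length-filter x∈ px = ∈-length (∈-filter⁺ P? x∈ px)

    2≤length-filter : ∀ {x y xs} → x ∈ xs → y ∈ xs → x ≢ y → P x → P y →
                      2 ≤ length (filter P? xs)
    2≤length-filter x∈ y∈ x≢y px py =
      ∈-≢⇒2≤length (∈-filter⁺ P? x∈ px) (∈-filter⁺ P? y∈ py) x≢y

    length-filter≤1 : ∀ {xs} → Unique xs → (∀ {x y} → P x → P y → x ≡ y) →
                      length (filter P? xs) ≤ 1
    length-filter≤1 {xs} xs! P-const = unique-constant⇒length≤1 {filter P? xs} (filter⁺ P? xs!)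
      (λ x∈ y∈ → P-const (proj₂ (∈-filter⁻ P? {xs = xs} x∈)) (proj₂ (∈-filter⁻ P? {xs = xs} y∈)))

  foldr-⊓-map-≤ : ∀ (f : A → ℕ) e {x} xs → x ∈ xs → foldr _⊓_ e (map f xs) ≤ f x
  foldr-⊓-map-≤ f e (y ∷ _)  (here refl) = m⊓n≤m (f y) _
  foldr-⊓-map-≤ f e (y ∷ ys) (there x∈)  = ≤-trans (m⊓n≤n (f y) _) (foldr-⊓-map-≤ f e ys x∈)

  foldr-⊓-map-glb : ∀ (f : A → ℕ) {k e} xs → k ≤ e → (∀ x → k ≤ f x) → k ≤ foldr _⊓_ e (map f xs)
  foldr-⊓-map-glb f []       k≤e _    = k≤e
  foldr-⊓-map-glb f (x ∷ xs) k≤e k≤f = ⊓-glb (k≤f x) (foldr-⊓-map-glb f xs k≤e k≤f)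

injective⇒strictlySurjective : ∀ {n} {f : Fin n → Fin n} →
                               Injective _≡_ _≡_ f → StrictlySurjective _≡_ f
injective⇒strictlySurjective {suc n} {f} f-inj y with any? (λ x → f x ≟ y)
... | yes hit  = hit
... | no  miss = contradiction (injective⇒≤ {f = f∖y} f∖y-injective) 1+n≰n
  where
  y≢f : ∀ x → y ≢ f x
  y≢f x y≡fx = miss (x , sym y≡fx)
  f∖y : Fin (suc n) → Fin n
  f∖y x = punchOut (y≢f x)
  f∖y-injective : Injective _≡_ _≡_ f∖y
  f∖y-injective eq = f-inj (punchOut-injective (y≢f _) (y≢f _) eq)

injective⇒bijective : ∀ {n} {f : Fin n → Fin n} → Injective _≡_ _≡_ f → Bijective _≡_ _≡_ f
injective⇒bijective f-inj =
  f-inj , strictlySurjective⇒surjective (injective⇒strictlySurjective f-inj)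

⟨$⟩ˡ-injective : ∀ {n} (π : Permutation′ n) → Injective _≡_ _≡_ (π ⟨$⟩ˡ_)
⟨$⟩ˡ-injective π = Bijection.injective (↔⇒⤖ (flip π))

module _ {n : ℕ} (G : FiniteGroup n) where
  open FiniteGroup G using (_∙_; ε; _⁻¹; isGroup; assoc; identityˡ)

  group : Group 0ℓ 0ℓ
  group = record
    { Carrier = Fin n ; _≈_ = _≡_ ; _∙_ = _∙_ ; ε = ε ; _⁻¹ = _⁻¹ ; isGroup = isGroup }

  open Group group using (_\\_; _//_)
  open GroupProperties group
    using (\\-leftDividesˡ; //-rightDividesˡ; x≈z//y; y≈x\\z; ε⁻¹≈ε;
           ⁻¹-injective; ⁻¹-anti-homo-\\)

  //≡⇒\\≡ : ∀ {a b h} → a // h ≡ b → b \\ a ≡ h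
  //≡⇒\\≡ {a} {h = h} refl = sym (y≈x\\z (a // h) h a (//-rightDividesˡ h a))

  \\≡⇒//≡ : ∀ {a b h} → b \\ a ≡ h → a // h ≡ b
  \\≡⇒//≡ {a} {b} refl = sym (x≈z//y b (b \\ a) a (\\-leftDividesˡ b a))

  \\-cancelˡ : ∀ (a b c : Fin n) → (a \\ b) \\ (a \\ c) ≡ b \\ c
  \\-cancelˡ a b c = begin
    (a \\ b) ⁻¹ ∙ (a \\ c)  ≡⟨ cong (_∙ (a \\ c)) (⁻¹-anti-homo-\\ a b) ⟩
    (b \\ a) ∙ (a \\ c)     ≡⟨ assoc (b ⁻¹) a (a \\ c) ⟩
    b ⁻¹ ∙ (a ∙ (a \\ c))   ≡⟨ cong (b ⁻¹ ∙_) (\\-leftDividesˡ a c) ⟩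
    b \\ c                  ∎
    where open ≡-Reasoning

  rowQuotient : (Fin n → Fin n) → (Fin n → Fin n) → Fin n → Fin n
  rowQuotient r s c = r c ⁻¹ ∙ s c

  rowQuotient-leftInvariant : ∀ (a r s : Fin n → Fin n) →
    rowQuotient (λ c → a c \\ r c) (λ c → a c \\ s c) ≗ rowQuotient r s
  rowQuotient-leftInvariant a r s c = \\-cancelˡ (a c) (r c) (s c)

  rowQuotient-ε-injective : ∀ {r} → Injective _≡_ _≡_ r →
                            Injective _≡_ _≡_ (rowQuotient (const ε) r)
  rowQuotient-ε-injective = ≗-injective (λ c → sym (trans (cong (_∙ _) ε⁻¹≈ε) (identityˡ _)))

  rowQuotient-swap-injective : ∀ {r s} → Injective _≡_ _≡_ (rowQuotient r s) →
                               Injective _≡_ _≡_ (rowQuotient s r)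
  rowQuotient-swap-injective {r} {s} inj {x} {y} eq = inj (⁻¹-injective (begin
    (r x \\ s x) ⁻¹  ≡⟨ ⁻¹-anti-homo-\\ (r x) (s x) ⟩
    s x \\ r x       ≡⟨ eq ⟩
    s y \\ r y       ≡⟨ ⁻¹-anti-homo-\\ (r y) (s y) ⟨
    (r y \\ s y) ⁻¹  ∎))
    where open ≡-Reasoning

  module _ (θ θ′ : Permutation′ n) where

    private
      δ : Fin n → Fin n
      δ = rowQuotient (θ ⟨$⟩ˡ_) (θ′ ⟨$⟩ˡ_)

      relative : Fin n → Fin n → Fin n
      relative h g = θ ⟨$⟩ʳ ((γ G h ∘ₚ θ′) ⟨$⟩ˡ g)

      fixed? : ∀ h → Decidable (λ g → relative h g ≡ g)
      fixed? h g = relative h g ≟ g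

      fixed⇒δ≡ : ∀ {h g} → relative h g ≡ g → δ g ≡ h
      fixed⇒δ≡ fixed = //≡⇒\\≡ (trans (sym (inverseˡ θ)) (cong (θ ⟨$⟩ˡ_) fixed))

      δ≡⇒fixed : ∀ {h g} → δ g ≡ h → relative h g ≡ g
      δ≡⇒fixed δg≡h = trans (cong (θ ⟨$⟩ʳ_) (\\≡⇒//≡ δg≡h)) (inverseʳ θ)

      fixCount≤n : ∀ h → fixCount (relative h) ≤ n
      fixCount≤n h =
        ≤-trans (length-filter (fixed? h) (allFin n)) (≤-reflexive (length-tabulate id))

      fixCount≥1 : ∀ g → 1 ≤ fixCount (relative (δ g))
      fixCount≥1 g = 1≤length-filter (fixed? (δ g)) (∈-allFin g) (δ≡⇒fixed refl)

      fixCount≥2 : ∀ {g g′} → g ≢ g′ → δ g ≡ δ g′ → 2 ≤ fixCount (relative (δ g))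
      fixCount≥2 {g} {g′} g≢g′ δg≡δg′ = 2≤length-filter (fixed? (δ g)) (∈-allFin g) (∈-allFin g′)
        g≢g′ (δ≡⇒fixed refl) (δ≡⇒fixed (sym δg≡δg′))

      fixCount≤1 : Injective _≡_ _≡_ δ → ∀ h → fixCount (relative h) ≤ 1
      fixCount≤1 δ-inj h = length-filter≤1 (fixed? h) (allFin⁺ n)
        (λ fixed fixed′ → δ-inj (trans (fixed⇒δ≡ fixed) (sym (fixed⇒δ≡ fixed′))))

      distance : Fin n → ℕ
      distance h = hamming (γ G h ∘ₚ θ′) θ

    distRθ≡n∸1⇔injective : distRθ G θ′ θ ≡ n ∸ 1 ⇔
                           Injective _≡_ _≡_ (rowQuotient (θ ⟨$⟩ˡ_) (θ′ ⟨$⟩ˡ_))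
    distRθ≡n∸1⇔injective = mk⇔ injective distRθ≡n∸1
      where
      open ≤-Reasoning

      injective : distRθ G θ′ θ ≡ n ∸ 1 → Injective _≡_ _≡_ δ
      injective d≡n∸1 {g} {g′} δg≡δg′ with g ≟ g′
      ... | yes g≡g′ = g≡g′
      ... | no  g≢g′ = contradiction (begin-strict
        n ∸ 1                          ≡⟨ d≡n∸1 ⟨
        distRθ G θ′ θ                  ≤⟨ foldr-⊓-map-≤ distance n (allFin n) (∈-allFin (δ g)) ⟩
        n ∸ fixCount (relative (δ g))  <⟨ ∸-monoʳ-< (fixCount≥2 g≢g′ δg≡δg′) (fixCount≤n (δ g)) ⟩
        n ∸ 1                          ∎) (<-irrefl refl)

      distRθ≡n∸1 : Injective _≡_ _≡_ δ → distRθ G θ′ θ ≡ n ∸ 1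
      distRθ≡n∸1 δ-inj = ≤-antisym
        (≤-trans (foldr-⊓-map-≤ distance n (allFin n) (∈-allFin (δ ε)))
                 (∸-monoʳ-≤ n (fixCount≥1 ε)))
        (foldr-⊓-map-glb distance (allFin n) (m∸n≤m n 1) (λ h → ∸-monoʳ-≤ n (fixCount≤1 δ-inj h)))

  MaximallyDistantFamily : ℕ → Set
  MaximallyDistantFamily m = Σ (Fin (suc m) → Permutation′ n) (λ θ →
    (∀ g → θ zero ⟨$⟩ʳ g ≡ g)
    × (∀ (i i′ : Fin (suc m)) → ¬ (i ≡ i′) → distRθ G (θ i′) (θ i) ≡ n ∸ 1))

  differenceMatrix⇒maximallyDistantFamily : ∀ {m} →
    DifferenceMatrixExists G (suc (suc m)) → MaximallyDistantFamily m
  differenceMatrix⇒maximallyDistantFamily {m} (D , D-difference) =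
    θ , (λ _ → inverseʳ σ₀) , separated
    where
    σ : Fin (suc m) → Permutation′ n
    σ i = ⤖⇒↔ (mk⤖ (D-difference zero (suc i) λ ()))
    σ₀ : Permutation′ n
    σ₀ = σ zero
    -- θᵢ⁻¹ = σᵢ ∘ σ₀⁻¹ is row i + 1 of the normalised matrix after relabelling the columns by σ₀
    θ : Fin (suc m) → Permutation′ n
    θ i = flip (flip σ₀ ∘ₚ σ i)
    separated : ∀ i i′ → i ≢ i′ → distRθ G (θ i′) (θ i) ≡ n ∸ 1
    separated i i′ i≢i′ = Equivalence.from (distRθ≡n∸1⇔injective (θ i) (θ i′))
      (≗-injective
        (λ c → sym (rowQuotient-leftInvariant (D zero) (D (suc i)) (D (suc i′)) (σ₀ ⟨$⟩ˡ c)))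
        (Composition.injective _≡_ _≡_ _≡_ (⟨$⟩ˡ-injective σ₀)
          (proj₁ (D-difference (suc i) (suc i′) (i≢i′ ∘ suc-injective)))))

  maximallyDistantFamily⇒differenceMatrix : ∀ {m} →
    MaximallyDistantFamily m → DifferenceMatrixExists G (suc (suc m))
  maximallyDistantFamily⇒differenceMatrix (θ , _ , separated) =
    D , λ i j i≢j → injective⇒bijective (rowQuotient-injective i j i≢j)
    where
    D : Fin _ → Fin n → Fin n
    D zero    _ = ε
    D (suc i)   = θ i ⟨$⟩ˡ_
    rowQuotient-injective : ∀ i j → i ≢ j → Injective _≡_ _≡_ (rowQuotient (D i) (D j))
    rowQuotient-injective zero    zero    i≢j = ⊥-elim (i≢j refl)
    rowQuotient-injective zero    (suc j) _   = rowQuotient-ε-injective (⟨$⟩ˡ-injective (θ j))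
    rowQuotient-injective (suc i) zero    _   =
      rowQuotient-swap-injective (rowQuotient-ε-injective (⟨$⟩ˡ-injective (θ i)))
    rowQuotient-injective (suc i) (suc j) i≢j =
      Equivalence.to (distRθ≡n∸1⇔injective (θ i) (θ j)) (separated i j (i≢j ∘ cong suc))

proposition1 : (n : ℕ) (G : FiniteGroup n) (m : ℕ) →
    DifferenceMatrixExists G (suc (suc m))
    ⇔ Σ (Fin (suc m) → Permutation′ n) (λ θ →
        (∀ g → θ zero ⟨$⟩ʳ g ≡ g)
        × (∀ (i i′ : Fin (suc m)) → ¬ (i ≡ i′) → distRθ G (θ i′) (θ i) ≡ n ∸ 1))
proposition1 n G m =
  mk⇔ (differenceMatrix⇒maximallyDistantFamily G) (maximallyDistantFamily⇒differenceMatrix G)
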